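{- For all integers $k,n\geq 1$, $$\zeta^*(k+1,\underbrace{1,\dots,1}_{n})=\sum_{t=1}^{n+1}\ \sum_{\substack{a_1+a_2+\dots+a_t=n+1-t\\ a_i\geq 0,\ i=1,\dots,t}} \zeta(a_t+k+1,\,a_1+1,\,a_2+1,\dots,a_{t-1}+1).$$
   Context: For an admissible index $(k_1,\dots,k_m)$ (positive integers with $k_1\geq 2$), $\zeta(k_1,\dots,k_m)=\sum_{m_1>\dots>m_m\geq 1} m_1^{ -k_1}\cdots m_m^{ -k_m}$ and $\zeta^*(k_1,\dots,k_m)=\sum_{m_1\geq\dots\geq m_m\geq 1} m_1^{ -k_1}\cdots m_m^{ -k_m}$. $\underbrace{1,\dots,1}_{n}$ denotes $n$ entries equal to $1$. For $t=1$ the index on the right is the single entry $(a_1+k+1)$. -}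

module Defs where

open import Data.Nat as ℕ using (ℕ; zero; suc; _^_)
open import Data.Nat.Properties using (m^n≢0)
open import Data.Integer using (+_)
open import Data.Rational using (ℚ; 0ℚ; 1ℚ; _/_; _+_; _*_)
open import Data.List using (List; []; _∷_; map; concatMap; upTo; foldr; replicate; _++_)

inv^ : ℕ → ℕ → ℚ
inv^ j k = (+ 1 / (suc j ^ k)) {{m^n≢0 (suc j) k}}

sumℚ : List ℚ → ℚ
sumℚ = foldr _+_ 0ℚ

-- Truncated multiple zeta value:
-- ζ_M(k₁,…,k_r) = Σ_{M ≥ m₁ > m₂ > … > m_r ≥ 1} m₁^{-k₁} ⋯ m_r^{-k_r}
ζ≤ : List ℕ → ℕ → ℚ
ζ≤ []       M = 1ℚ
ζ≤ (k ∷ ks) M = sumℚ (map (λ j → inv^ j k * ζ≤ ks j) (upTo M))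
-- (j ranges over 0..M-1, i.e. m₁ = j+1 ∈ [1,M], next variables < m₁, i.e. ≤ j)

-- Truncated multiple zeta-star value:
-- ζ*_M(k₁,…,k_r) = Σ_{M ≥ m₁ ≥ m₂ ≥ … ≥ m_r ≥ 1} m₁^{-k₁} ⋯ m_r^{-k_r}
ζ*≤ : List ℕ → ℕ → ℚ
ζ*≤ []       M = 1ℚ
ζ*≤ (k ∷ ks) M = sumℚ (map (λ j → inv^ j k * ζ*≤ ks (suc j)) (upTo M))

comps : ℕ → ℕ → List (List ℕ)
comps zero    zero    = [] ∷ []
comps zero    (suc s) = []
comps (suc t) s       = concatMap (λ a → map (a ∷_) (comps t (s ℕ.∸ a))) (upTo (suc s))
  -- careful: for a ≤ s the rest sums to s ∸ a
-- note: a ranges over 0..s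

-- The index (a_t+k+1, a₁+1, …, a_{t-1}+1) built from (a₁,…,a_t)
rhsIndex : ℕ → List ℕ → List ℕ
rhsIndex k as = go as []
  where
  go : List ℕ → List ℕ → List ℕ
  go []       acc = []
  go (a ∷ []) acc = (a ℕ.+ k ℕ.+ 1) ∷ acc
  go (a ∷ b ∷ rest) acc = go (b ∷ rest) (acc ++ ((a ℕ.+ 1) ∷ []))

rhsIndices : ℕ → ℕ → List (List ℕ)
rhsIndices k n = concatMap (λ i → map (rhsIndex k) (comps (suc i) (n ℕ.∸ i))) (upTo (suc n))
  -- t = suc i ranges over 1..n+1, and n+1-t = n ∸ i

{-# OPTIONS --safe #-}

-- Splitting the sum defining ζ*_M(k₁, k₂, …) into the terms with m₁ > m₂ and
-- those with m₁ = m₂, and iterating, shows that the truncated ζ*_M(k) is the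
-- sum of ζ_M over all coarsenings of k (indices obtained by adding up blocks of
-- consecutive entries).  A coarsening of (k+1, 1, …, 1) is (k+1+c, d₁, …, d_t)
-- with (d₁, …, d_t) a composition of n − c into positive parts, and the
-- right-hand side enumerates exactly these, (a₁, …, a_t) corresponding to
-- c = a_t and d_i = a_i + 1.  So the identity holds exactly for every
-- truncation M and all k, n; one can take N = 0.

module Submission where

open import Defs
open import Data.Nat as ℕ using (ℕ; suc; _≥_)
open import Data.Rational using (ℚ; 0ℚ; _<_; _-_; ∣_∣)
open import Data.List using (_∷_; map; replicate)
open import Data.Product using (Σ; _×_)

open import Algebra.Bundles using (CommutativeMonoid)
import Algebra.Properties.CommutativeSemigroup as CommSemigroupProperties
open import Data.Nat using (zero; _∸_; _^_)
import Data.Nat.Properties as ℕₚ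
open import Data.Nat.GCD using (gcd; gcd-zeroˡ)
import Data.Integer as ℤ
import Data.Integer.Properties as ℤₚ
open import Data.Rational using (_+_; _*_; _/_; ↥_; ↧ₙ_)
import Data.Rational.Properties as ℚₚ
open import Data.List using (List; []; concatMap; upTo; _++_; [_])
import Data.List.Properties as Listₚ
open import Data.Product using (_,_)
open import Function using (_∘_; flip)
open import Relation.Binary.PropositionalEquality hiding ([_])
open ≡-Reasoning

private
  variable
    A B : Set

*gcd[1,n]-cancel : ∀ {i j} n → i ℤ.* ℤ.+ gcd 1 n ≡ j → i ≡ j
*gcd[1,n]-cancel {i} n eq =
  trans (sym (ℤₚ.*-identityʳ i)) (subst (λ g → i ℤ.* ℤ.+ g ≡ _) (gcd-zeroˡ n) eq)

↥[1/n] : ∀ n .{{_ : ℕ.NonZero n}} → ↥ (ℤ.+ 1 / n) ≡ ℤ.+ 1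
↥[1/n] n = *gcd[1,n]-cancel n (ℚₚ.↥-/ (ℤ.+ 1) n)

↧ₙ[1/n] : ∀ n .{{_ : ℕ.NonZero n}} → ↧ₙ (ℤ.+ 1 / n) ≡ n
↧ₙ[1/n] n = ℤₚ.+-injective (*gcd[1,n]-cancel n (ℚₚ.↧-/ (ℤ.+ 1) n))

*-as-/ : ∀ p q → p * q ≡ (↥ p ℤ.* ↥ q) / (↧ₙ p ℕ.* ↧ₙ q)
*-as-/ p@record{} q@record{} = refl

1/m*1/n≡1/mn : ∀ m n .{{_ : ℕ.NonZero m}} .{{_ : ℕ.NonZero n}} →
               (ℤ.+ 1 / m) * (ℤ.+ 1 / n) ≡ (ℤ.+ 1 / (m ℕ.* n)) {{ℕₚ.m*n≢0 m n}}
1/m*1/n≡1/mn m n = trans (*-as-/ (ℤ.+ 1 / m) (ℤ.+ 1 / n))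
  (ℚₚ./-cong (cong₂ ℤ._*_ (↥[1/n] m) (↥[1/n] n)) (cong₂ ℕ._*_ (↧ₙ[1/n] m) (↧ₙ[1/n] n)))
  where instance _ = ℕₚ.m*n≢0 m n

inv^-+ : ∀ j k l → inv^ j k * inv^ j l ≡ inv^ j (k ℕ.+ l)
inv^-+ j k l = trans (1/m*1/n≡1/mn (suc j ^ k) (suc j ^ l))
                     (ℚₚ./-cong {ℤ.+ 1} refl (sym (ℕₚ.^-distribˡ-+-* (suc j) k l)))
  where
  instance
    _ = ℕₚ.m^n≢0 (suc j) k
    _ = ℕₚ.m^n≢0 (suc j) l
    _ = ℕₚ.m^n≢0 (suc j) (k ℕ.+ l)
    _ = ℕₚ.m*n≢0 (suc j ^ k) (suc j ^ l)

∑ : List A → (A → ℚ) → ℚ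
∑ xs f = sumℚ (map f xs)

-- The body of ∑[ x ← xs ] extends over _*_ but not over _+_.
infix 6.5 ∑
syntax ∑ xs (λ x → e) = ∑[ x ← xs ] e

∑-cong : (xs : List A) {f g : A → ℚ} → (∀ x → f x ≡ g x) → ∑ xs f ≡ ∑ xs g
∑-cong []       f≗g = refl
∑-cong (x ∷ xs) f≗g = cong₂ _+_ (f≗g x) (∑-cong xs f≗g)

sumℚ-++ : ∀ ps qs → sumℚ (ps ++ qs) ≡ sumℚ ps + sumℚ qs
sumℚ-++ []       qs = sym (ℚₚ.+-identityˡ _)
sumℚ-++ (p ∷ ps) qs = trans (cong (p +_) (sumℚ-++ ps qs)) (sym (ℚₚ.+-assoc p _ _))

∑-++ : (xs ys : List A) (f : A → ℚ) → ∑ (xs ++ ys) f ≡ ∑ xs f + ∑ ys f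
∑-++ xs ys f = trans (cong sumℚ (Listₚ.map-++ f xs ys)) (sumℚ-++ (map f xs) (map f ys))

∑-map : (g : A → B) (xs : List A) (f : B → ℚ) → ∑ (map g xs) f ≡ ∑ xs (f ∘ g)
∑-map g xs f = cong sumℚ (sym (Listₚ.map-∘ xs))

∑-concatMap : (h : A → List B) (xs : List A) (f : B → ℚ) →
              ∑ (concatMap h xs) f ≡ ∑[ x ← xs ] ∑ (h x) f
∑-concatMap h []       f = refl
∑-concatMap h (x ∷ xs) f =
  trans (∑-++ (h x) (concatMap h xs) f) (cong (∑ (h x) f +_) (∑-concatMap h xs f))

∑-zero : (xs : List A) → ∑[ x ← xs ] 0ℚ ≡ 0ℚ
∑-zero []       = refl
∑-zero (x ∷ xs) = trans (ℚₚ.+-identityˡ _) (∑-zero xs)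

∑-distrib-+ : (xs : List A) (f g : A → ℚ) → ∑[ x ← xs ] (f x + g x) ≡ ∑ xs f + ∑ xs g
∑-distrib-+ []       f g = sym (ℚₚ.+-identityˡ 0ℚ)
∑-distrib-+ (x ∷ xs) f g =
  trans (cong (f x + g x +_) (∑-distrib-+ xs f g)) (interchange (f x) (g x) _ _)
  where open CommSemigroupProperties (CommutativeMonoid.commutativeSemigroup ℚₚ.+-0-commutativeMonoid)

*-distribˡ-∑ : (c : ℚ) (xs : List A) (f : A → ℚ) → c * ∑ xs f ≡ ∑[ x ← xs ] c * f x
*-distribˡ-∑ c []       f = ℚₚ.*-zeroʳ c
*-distribˡ-∑ c (x ∷ xs) f =
  trans (ℚₚ.*-distribˡ-+ c (f x) _) (cong (c * f x +_) (*-distribˡ-∑ c xs f))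

∑-comm : (xs : List A) (ys : List B) (f : A → B → ℚ) →
         ∑[ x ← xs ] ∑[ y ← ys ] f x y ≡ ∑[ y ← ys ] ∑[ x ← xs ] f x y
∑-comm []       ys f = sym (∑-zero ys)
∑-comm (x ∷ xs) ys f = begin
  ∑ ys (f x) + (∑[ x′ ← xs ] ∑[ y ← ys ] f x′ y) ≡⟨ cong (∑ ys (f x) +_) (∑-comm xs ys f) ⟩
  ∑ ys (f x) + (∑[ y ← ys ] ∑[ x′ ← xs ] f x′ y) ≡⟨ sym (∑-distrib-+ ys (f x) _) ⟩
  ∑[ y ← ys ] (f x y + ∑[ x′ ← xs ] f x′ y)    ∎

∑-upTo-suc : ∀ n (f : ℕ → ℚ) → ∑ (upTo (suc n)) f ≡ f 0 + (∑[ i ← upTo n ] f (suc i))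
∑-upTo-suc n f = cong (f 0 +_) (cong sumℚ
  (trans (Listₚ.map-applyUpTo suc f n) (sym (Listₚ.map-upTo (f ∘ suc) n))))

∑-upTo-∷ʳ : ∀ n (f : ℕ → ℚ) → ∑ (upTo (suc n)) f ≡ ∑ (upTo n) f + f n
∑-upTo-∷ʳ n f = begin
  ∑ (upTo (suc n)) f        ≡⟨ cong (λ is → ∑ is f) (sym (Listₚ.upTo-∷ʳ n)) ⟩
  ∑ (upTo n ++ [ n ]) f     ≡⟨ ∑-++ (upTo n) [ n ] f ⟩
  ∑ (upTo n) f + (f n + 0ℚ) ≡⟨ cong (∑ (upTo n) f +_) (ℚₚ.+-identityʳ (f n)) ⟩
  ∑ (upTo n) f + f n        ∎

∑△ : ℕ → (ℕ → ℕ → ℚ) → ℚ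
∑△ s g = ∑[ a ← upTo (suc s) ] ∑[ b ← upTo (suc (s ∸ a)) ] g a b

∑△-suc-row : ∀ s g → ∑△ (suc s) g ≡ ∑ (upTo (suc (suc s))) (g 0) + ∑△ s (g ∘ suc)
∑△-suc-row s g = ∑-upTo-suc (suc s) (λ a → ∑ (upTo (suc (suc s ∸ a))) (g a))

∑△-strict : ∀ s (h : ℕ → ℕ → ℚ) →
            ∑[ a ← upTo (suc (suc s)) ] ∑ (upTo (suc s ∸ a)) (h a) ≡ ∑△ s h
∑△-strict zero    h = refl
∑△-strict (suc s) h = begin
  ∑[ a ← upTo (suc (suc (suc s))) ] ∑ (upTo (suc (suc s) ∸ a)) (h a)
    ≡⟨ ∑-upTo-suc (suc (suc s)) (λ a → ∑ (upTo (suc (suc s) ∸ a)) (h a)) ⟩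
  ∑ (upTo (suc (suc s))) (h 0) + (∑[ a ← upTo (suc (suc s)) ] ∑ (upTo (suc s ∸ a)) (h (suc a)))
    ≡⟨ cong (∑ (upTo (suc (suc s))) (h 0) +_) (∑△-strict s (h ∘ suc)) ⟩
  ∑ (upTo (suc (suc s))) (h 0) + ∑△ s (h ∘ suc)
    ≡⟨ sym (∑△-suc-row s h) ⟩
  ∑△ (suc s) h ∎

∑△-suc-col : ∀ s g → ∑△ (suc s) g ≡ (∑[ a ← upTo (suc (suc s)) ] g a 0) + ∑△ s (λ a b → g a (suc b))
∑△-suc-col s g = begin
  ∑△ (suc s) g
    ≡⟨ ∑-cong (upTo (suc (suc s))) (λ a → ∑-upTo-suc (suc s ∸ a) (g a)) ⟩
  ∑[ a ← upTo (suc (suc s)) ] (g a 0 + ∑[ b ← upTo (suc s ∸ a) ] g a (suc b))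
    ≡⟨ ∑-distrib-+ (upTo (suc (suc s))) (λ a → g a 0) _ ⟩
  (∑[ a ← upTo (suc (suc s)) ] g a 0) + (∑[ a ← upTo (suc (suc s)) ] ∑[ b ← upTo (suc s ∸ a) ] g a (suc b))
    ≡⟨ cong ((∑[ a ← upTo (suc (suc s)) ] g a 0) +_) (∑△-strict s (λ a b → g a (suc b))) ⟩
  (∑[ a ← upTo (suc (suc s)) ] g a 0) + ∑△ s (λ a b → g a (suc b)) ∎

∑△-comm : ∀ s g → ∑△ s g ≡ ∑△ s (flip g)
∑△-comm zero    g = refl
∑△-comm (suc s) g = begin
  ∑△ (suc s) g                                         ≡⟨ ∑△-suc-row s g ⟩
  ∑ (upTo (suc (suc s))) (g 0) + ∑△ s (g ∘ suc)        ≡⟨ cong (∑ (upTo (suc (suc s))) (g 0) +_) (∑△-comm s (g ∘ suc)) ⟩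
  ∑ (upTo (suc (suc s))) (g 0) + ∑△ s (flip (g ∘ suc)) ≡⟨ sym (∑△-suc-col s (flip g)) ⟩
  ∑△ (suc s) (flip g)                                  ∎

∸-∸-comm : ∀ m n o → m ∸ n ∸ o ≡ m ∸ o ∸ n
∸-∸-comm m n o = begin
  m ∸ n ∸ o     ≡⟨ ℕₚ.∸-+-assoc m n o ⟩
  m ∸ (n ℕ.+ o) ≡⟨ cong (m ∸_) (ℕₚ.+-comm n o) ⟩
  m ∸ (o ℕ.+ n) ≡⟨ sym (ℕₚ.∸-+-assoc m o n) ⟩
  m ∸ o ∸ n     ∎

∑△-∸-comm : ∀ s (g : ℕ → ℕ → ℕ → ℚ) →
            ∑[ a ← upTo (suc s) ] ∑[ b ← upTo (suc (s ∸ a)) ] g a b (s ∸ a ∸ b)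
            ≡ ∑[ b ← upTo (suc s) ] ∑[ a ← upTo (suc (s ∸ b)) ] g a b (s ∸ b ∸ a)
∑△-∸-comm s g = trans (∑△-comm s (λ a b → g a b (s ∸ a ∸ b)))
  (∑-cong (upTo (suc s)) λ b → ∑-cong (upTo (suc (s ∸ b))) λ a → cong (g a b) (∸-∸-comm s a b))

ζ*≤-∷-∷ : ∀ k l ks M →
          ζ*≤ (k ∷ l ∷ ks) M ≡ (∑[ j ← upTo M ] inv^ j k * ζ*≤ (l ∷ ks) j) + ζ*≤ (k ℕ.+ l ∷ ks) M
ζ*≤-∷-∷ k l ks M = trans (∑-cong (upTo M) split) (∑-distrib-+ (upTo M) _ _)
  where
  split : ∀ j → inv^ j k * ζ*≤ (l ∷ ks) (suc j)
              ≡ inv^ j k * ζ*≤ (l ∷ ks) j + inv^ j (k ℕ.+ l) * ζ*≤ ks (suc j)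
  split j = begin
    inv^ j k * ζ*≤ (l ∷ ks) (suc j)
      ≡⟨ cong (inv^ j k *_) (∑-upTo-∷ʳ j (λ i → inv^ i l * ζ*≤ ks (suc i))) ⟩
    inv^ j k * (ζ*≤ (l ∷ ks) j + inv^ j l * ζ*≤ ks (suc j))
      ≡⟨ ℚₚ.*-distribˡ-+ (inv^ j k) _ _ ⟩
    inv^ j k * ζ*≤ (l ∷ ks) j + inv^ j k * (inv^ j l * ζ*≤ ks (suc j))
      ≡⟨ cong (inv^ j k * ζ*≤ (l ∷ ks) j +_) (sym (ℚₚ.*-assoc (inv^ j k) _ _)) ⟩
    inv^ j k * ζ*≤ (l ∷ ks) j + inv^ j k * inv^ j l * ζ*≤ ks (suc j)
      ≡⟨ cong (λ x → inv^ j k * ζ*≤ (l ∷ ks) j + x * ζ*≤ ks (suc j)) (inv^-+ j k l) ⟩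
    inv^ j k * ζ*≤ (l ∷ ks) j + inv^ j (k ℕ.+ l) * ζ*≤ ks (suc j) ∎

coarsenings : ℕ → List ℕ → List (List ℕ)
coarsenings k []       = [ k ∷ [] ]
coarsenings k (l ∷ ks) = map (k ∷_) (coarsenings l ks) ++ coarsenings (k ℕ.+ l) ks

ζ*≤-coarsenings : ∀ k ks M → ζ*≤ (k ∷ ks) M ≡ ∑[ ls ← coarsenings k ks ] ζ≤ ls M
ζ*≤-coarsenings k []       M = sym (ℚₚ.+-identityʳ _)
ζ*≤-coarsenings k (l ∷ ks) M = begin
  ζ*≤ (k ∷ l ∷ ks) M
    ≡⟨ ζ*≤-∷-∷ k l ks M ⟩
  (∑[ j ← upTo M ] inv^ j k * ζ*≤ (l ∷ ks) j) + ζ*≤ (k ℕ.+ l ∷ ks) M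
    ≡⟨ cong₂ _+_ (∑-cong (upTo M) (λ j → cong (inv^ j k *_) (ζ*≤-coarsenings l ks j)))
                 (ζ*≤-coarsenings (k ℕ.+ l) ks M) ⟩
  (∑[ j ← upTo M ] inv^ j k * (∑[ ls ← coarsenings l ks ] ζ≤ ls j)) + merged
    ≡⟨ cong (_+ merged) (∑-cong (upTo M) (λ j → *-distribˡ-∑ (inv^ j k) (coarsenings l ks) _)) ⟩
  (∑[ j ← upTo M ] ∑[ ls ← coarsenings l ks ] inv^ j k * ζ≤ ls j) + merged
    ≡⟨ cong (_+ merged) (∑-comm (upTo M) (coarsenings l ks) _) ⟩
  (∑[ ls ← coarsenings l ks ] ζ≤ (k ∷ ls) M) + merged
    ≡⟨ cong (_+ merged) (sym (∑-map (k ∷_) (coarsenings l ks) (λ ls → ζ≤ ls M))) ⟩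
  (∑[ ls ← map (k ∷_) (coarsenings l ks) ] ζ≤ ls M) + merged
    ≡⟨ sym (∑-++ (map (k ∷_) (coarsenings l ks)) _ _) ⟩
  ∑[ ls ← coarsenings k (l ∷ ks) ] ζ≤ ls M ∎
  where
  merged : ℚ
  merged = ∑[ ls ← coarsenings (k ℕ.+ l) ks ] ζ≤ ls M

∑-comps-suc : ∀ i s (f : List ℕ → ℚ) →
              ∑ (comps (suc i) s) f ≡ ∑[ a ← upTo (suc s) ] ∑[ bs ← comps i (s ∸ a) ] f (a ∷ bs)
∑-comps-suc i s f = trans (∑-concatMap (λ a → map (a ∷_) (comps i (s ∸ a))) (upTo (suc s)) f)
  (∑-cong (upTo (suc s)) λ a → ∑-map (a ∷_) (comps i (s ∸ a)) f)

∑-comps-suc-∷ʳ : ∀ i s (f : List ℕ → ℚ) →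
                 ∑ (comps (suc i) s) f ≡ ∑[ a ← upTo (suc s) ] ∑[ bs ← comps i (s ∸ a) ] f (bs ++ [ a ])
∑-comps-suc-∷ʳ zero s f =
  trans (∑-comps-suc 0 s f) (∑-cong (upTo (suc s)) λ a → singleton (s ∸ a) a)
  where
  singleton : ∀ r a → ∑[ bs ← comps 0 r ] f (a ∷ bs) ≡ ∑[ bs ← comps 0 r ] f (bs ++ [ a ])
  singleton zero    a = refl
  singleton (suc r) a = refl
∑-comps-suc-∷ʳ (suc i) s f = begin
  ∑ (comps (suc (suc i)) s) f
    ≡⟨ ∑-comps-suc (suc i) s f ⟩
  ∑[ a ← upTo (suc s) ] ∑[ bs ← comps (suc i) (s ∸ a) ] f (a ∷ bs)
    ≡⟨ ∑-cong (upTo (suc s)) (λ a → ∑-comps-suc-∷ʳ i (s ∸ a) (f ∘ (a ∷_))) ⟩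
  ∑[ a ← upTo (suc s) ] ∑[ b ← upTo (suc (s ∸ a)) ] ∑[ cs ← comps i (s ∸ a ∸ b) ] f (a ∷ cs ++ [ b ])
    ≡⟨ ∑△-∸-comm s (λ a b r → ∑[ cs ← comps i r ] f (a ∷ cs ++ [ b ])) ⟩
  ∑[ b ← upTo (suc s) ] ∑[ a ← upTo (suc (s ∸ b)) ] ∑[ cs ← comps i (s ∸ b ∸ a) ] f (a ∷ cs ++ [ b ])
    ≡⟨ ∑-cong (upTo (suc s)) (λ b → sym (∑-comps-suc i (s ∸ b) (λ bs → f (bs ++ [ b ])))) ⟩
  ∑[ b ← upTo (suc s) ] ∑[ bs ← comps (suc i) (s ∸ b) ] f (bs ++ [ b ]) ∎

positiveCompositions : ℕ → List (List ℕ)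
positiveCompositions m = concatMap (λ i → map (map suc) (comps i (m ∸ i))) (upTo (suc m))

∑-positiveCompositions : ∀ m (g : List ℕ → ℚ) →
  ∑ (positiveCompositions m) g ≡ ∑[ i ← upTo (suc m) ] ∑[ bs ← comps i (m ∸ i) ] g (map suc bs)
∑-positiveCompositions m g =
  trans (∑-concatMap (λ i → map (map suc) (comps i (m ∸ i))) (upTo (suc m)) g)
  (∑-cong (upTo (suc m)) λ i → ∑-map (map suc) (comps i (m ∸ i)) g)

∑-positiveCompositions-exchange : ∀ m (h : ℕ → List ℕ → ℚ) →
  ∑[ i ← upTo (suc m) ] ∑[ a ← upTo (suc (m ∸ i)) ] ∑[ bs ← comps i (m ∸ i ∸ a) ] h a (map suc bs)
  ≡ ∑[ a ← upTo (suc m) ] ∑[ ls ← positiveCompositions (m ∸ a) ] h a ls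
∑-positiveCompositions-exchange m h =
  trans (∑△-∸-comm m (λ i a r → ∑[ bs ← comps i r ] h a (map suc bs)))
        (∑-cong (upTo (suc m)) λ a → sym (∑-positiveCompositions (m ∸ a) (h a)))

∑-positiveCompositions-suc : ∀ m (g : List ℕ → ℚ) →
  ∑ (positiveCompositions (suc m)) g
  ≡ ∑[ c ← upTo (suc m) ] ∑[ ls ← positiveCompositions (m ∸ c) ] g (suc c ∷ ls)
∑-positiveCompositions-suc m g = begin
  ∑ (positiveCompositions (suc m)) g
    ≡⟨ ∑-positiveCompositions (suc m) g ⟩
  ∑[ i ← upTo (suc (suc m)) ] ∑[ bs ← comps i (suc m ∸ i) ] g (map suc bs)
    ≡⟨ ∑-upTo-suc (suc m) (λ i → ∑[ bs ← comps i (suc m ∸ i) ] g (map suc bs)) ⟩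
  0ℚ + ∑[ i ← upTo (suc m) ] ∑[ bs ← comps (suc i) (m ∸ i) ] g (map suc bs)
    ≡⟨ ℚₚ.+-identityˡ _ ⟩
  ∑[ i ← upTo (suc m) ] ∑[ bs ← comps (suc i) (m ∸ i) ] g (map suc bs)
    ≡⟨ ∑-cong (upTo (suc m)) (λ i → ∑-comps-suc i (m ∸ i) (g ∘ map suc)) ⟩
  ∑[ i ← upTo (suc m) ] ∑[ a ← upTo (suc (m ∸ i)) ] ∑[ bs ← comps i (m ∸ i ∸ a) ] g (suc a ∷ map suc bs)
    ≡⟨ ∑-positiveCompositions-exchange m (λ a ls → g (suc a ∷ ls)) ⟩
  ∑[ c ← upTo (suc m) ] ∑[ ls ← positiveCompositions (m ∸ c) ] g (suc c ∷ ls) ∎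

∑-coarsenings-replicate : ∀ k n (f : List ℕ → ℚ) →
  ∑ (coarsenings k (replicate n 1)) f
  ≡ ∑[ c ← upTo (suc n) ] ∑[ ls ← positiveCompositions (n ∸ c) ] f (k ℕ.+ c ∷ ls)
∑-coarsenings-replicate k zero f =
  trans (cong (λ k′ → f (k′ ∷ []) + 0ℚ) (sym (ℕₚ.+-identityʳ k))) (sym (ℚₚ.+-identityʳ _))
∑-coarsenings-replicate k (suc n) f = begin
  ∑ (map (k ∷_) (coarsenings 1 (replicate n 1)) ++ coarsenings (k ℕ.+ 1) (replicate n 1)) f
    ≡⟨ ∑-++ (map (k ∷_) (coarsenings 1 (replicate n 1))) _ f ⟩
  ∑ (map (k ∷_) (coarsenings 1 (replicate n 1))) f + ∑ (coarsenings (k ℕ.+ 1) (replicate n 1)) f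
    ≡⟨ cong (_+ ∑ (coarsenings (k ℕ.+ 1) (replicate n 1)) f) (∑-map (k ∷_) (coarsenings 1 (replicate n 1)) f) ⟩
  ∑ (coarsenings 1 (replicate n 1)) (f ∘ (k ∷_)) + ∑ (coarsenings (k ℕ.+ 1) (replicate n 1)) f
    ≡⟨ cong₂ _+_ (∑-coarsenings-replicate 1 n (f ∘ (k ∷_))) (∑-coarsenings-replicate (k ℕ.+ 1) n f) ⟩
  (∑[ c ← upTo (suc n) ] ∑[ ls ← positiveCompositions (n ∸ c) ] f (k ∷ suc c ∷ ls))
    + (∑[ c ← upTo (suc n) ] ∑[ ls ← positiveCompositions (n ∸ c) ] f (k ℕ.+ 1 ℕ.+ c ∷ ls))
    ≡⟨ cong₂ _+_ (trans (sym (∑-positiveCompositions-suc n (f ∘ (k ∷_))))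
                        (first-part (suc n) (sym (ℕₚ.+-identityʳ k))))
                 (∑-cong (upTo (suc n)) λ c → first-part (n ∸ c) (ℕₚ.+-assoc k 1 c)) ⟩
  (∑[ ls ← positiveCompositions (suc n) ] f (k ℕ.+ 0 ∷ ls))
    + (∑[ c ← upTo (suc n) ] ∑[ ls ← positiveCompositions (n ∸ c) ] f (k ℕ.+ suc c ∷ ls))
    ≡⟨ sym (∑-upTo-suc (suc n) λ c → ∑[ ls ← positiveCompositions (suc n ∸ c) ] f (k ℕ.+ c ∷ ls)) ⟩
  ∑[ c ← upTo (suc (suc n)) ] ∑[ ls ← positiveCompositions (suc n ∸ c) ] f (k ℕ.+ c ∷ ls) ∎
  where
  first-part : ∀ {l l′} m → l ≡ l′ →
               ∑[ ls ← positiveCompositions m ] f (l ∷ ls) ≡ ∑[ ls ← positiveCompositions m ] f (l′ ∷ ls)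
  first-part m refl = refl

-- Defs.rhsIndex is computed by a local helper that cannot be named outside
-- Defs; rhsIndexGo k as is that helper, recovered by solving a metavariable.
mutual
  rhsIndexGo : ℕ → List ℕ → List ℕ → List ℕ → List ℕ
  rhsIndexGo = _

  rhsIndex-∷-∷ : ∀ k b c cs →
                 rhsIndex k (b ∷ c ∷ cs) ≡ rhsIndexGo k (b ∷ c ∷ cs) (c ∷ cs) [ b ℕ.+ 1 ]
  rhsIndex-∷-∷ k b c cs with c ∷ cs | [ b ℕ.+ 1 ]
  ... | xs | acc with b ∷ xs
  ... | as = refl

rhsIndexGo-∷ʳ : ∀ k as bs a acc →
                rhsIndexGo k as (bs ++ [ a ]) acc ≡ a ℕ.+ k ℕ.+ 1 ∷ acc ++ map (ℕ._+ 1) bs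
rhsIndexGo-∷ʳ k as []           a acc = cong (a ℕ.+ k ℕ.+ 1 ∷_) (sym (Listₚ.++-identityʳ acc))
rhsIndexGo-∷ʳ k as (b ∷ [])     a acc = refl
rhsIndexGo-∷ʳ k as (b ∷ c ∷ cs) a acc =
  trans (rhsIndexGo-∷ʳ k as (c ∷ cs) a (acc ++ [ b ℕ.+ 1 ]))
        (cong (a ℕ.+ k ℕ.+ 1 ∷_) (Listₚ.++-assoc acc [ b ℕ.+ 1 ] (map (ℕ._+ 1) (c ∷ cs))))

rhsIndex-∷ʳ : ∀ k bs a → rhsIndex k (bs ++ [ a ]) ≡ suc k ℕ.+ a ∷ map suc bs
rhsIndex-∷ʳ k bs a = trans (unfolded bs)
  (cong₂ _∷_ (trans (ℕₚ.+-comm (a ℕ.+ k) 1) (cong suc (ℕₚ.+-comm a k)))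
             (Listₚ.map-cong (λ x → ℕₚ.+-comm x 1) bs))
  where
  unfolded : ∀ bs → rhsIndex k (bs ++ [ a ]) ≡ a ℕ.+ k ℕ.+ 1 ∷ map (ℕ._+ 1) bs
  unfolded []           = refl
  unfolded (b ∷ [])     = refl
  unfolded (b ∷ c ∷ cs) =
    trans (rhsIndex-∷-∷ k b c (cs ++ [ a ])) (rhsIndexGo-∷ʳ k (b ∷ c ∷ cs ++ [ a ]) (c ∷ cs) a [ b ℕ.+ 1 ])

∑-rhsIndices : ∀ k n (f : List ℕ → ℚ) →
  ∑ (rhsIndices k n) f
  ≡ ∑[ c ← upTo (suc n) ] ∑[ ls ← positiveCompositions (n ∸ c) ] f (suc k ℕ.+ c ∷ ls)
∑-rhsIndices k n f = begin
  ∑ (rhsIndices k n) f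
    ≡⟨ ∑-concatMap (λ i → map (rhsIndex k) (comps (suc i) (n ∸ i))) (upTo (suc n)) f ⟩
  ∑[ i ← upTo (suc n) ] ∑ (map (rhsIndex k) (comps (suc i) (n ∸ i))) f
    ≡⟨ ∑-cong (upTo (suc n)) (λ i → ∑-map (rhsIndex k) (comps (suc i) (n ∸ i)) f) ⟩
  ∑[ i ← upTo (suc n) ] ∑[ as ← comps (suc i) (n ∸ i) ] f (rhsIndex k as)
    ≡⟨ ∑-cong (upTo (suc n)) (λ i → ∑-comps-suc-∷ʳ i (n ∸ i) (f ∘ rhsIndex k)) ⟩
  ∑[ i ← upTo (suc n) ] ∑[ a ← upTo (suc (n ∸ i)) ] ∑[ bs ← comps i (n ∸ i ∸ a) ] f (rhsIndex k (bs ++ [ a ]))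
    ≡⟨ ∑-cong (upTo (suc n)) (λ i → ∑-cong (upTo (suc (n ∸ i))) λ a →
         ∑-cong (comps i (n ∸ i ∸ a)) λ bs → cong f (rhsIndex-∷ʳ k bs a)) ⟩
  ∑[ i ← upTo (suc n) ] ∑[ a ← upTo (suc (n ∸ i)) ] ∑[ bs ← comps i (n ∸ i ∸ a) ] f (suc k ℕ.+ a ∷ map suc bs)
    ≡⟨ ∑-positiveCompositions-exchange n (λ a ls → f (suc k ℕ.+ a ∷ ls)) ⟩
  ∑[ c ← upTo (suc n) ] ∑[ ls ← positiveCompositions (n ∸ c) ] f (suc k ℕ.+ c ∷ ls) ∎

∑-coarsenings-replicate≡∑-rhsIndices : ∀ k n (f : List ℕ → ℚ) →
  ∑ (coarsenings (suc k) (replicate n 1)) f ≡ ∑ (rhsIndices k n) f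
∑-coarsenings-replicate≡∑-rhsIndices k n f =
  trans (∑-coarsenings-replicate (suc k) n f) (sym (∑-rhsIndices k n f))

ζ*≤-rhsIndices : ∀ k n M →
  ζ*≤ (suc k ∷ replicate n 1) M ≡ sumℚ (map (λ ks → ζ≤ ks M) (rhsIndices k n))
ζ*≤-rhsIndices k n M = trans (ζ*≤-coarsenings (suc k) (replicate n 1) M)
                             (∑-coarsenings-replicate≡∑-rhsIndices k n (λ ks → ζ≤ ks M))

proposition2p3 : (k n : ℕ) → k ≥ 1 → n ≥ 1 →
    (ε : ℚ) → 0ℚ < ε → Σ ℕ λ N → (M : ℕ) → M ≥ N →
      ∣ ζ*≤ (suc k ∷ replicate n 1) M - sumℚ (map (λ ks → ζ≤ ks M) (rhsIndices k n)) ∣ < ε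
proposition2p3 k n _ _ ε 0<ε = 0 , λ M _ → subst (λ x → ∣ x ∣ < ε) (sym (difference≡0 M)) 0<ε
  where
  difference≡0 : ∀ M → ζ*≤ (suc k ∷ replicate n 1) M - sumℚ (map (λ ks → ζ≤ ks M) (rhsIndices k n)) ≡ 0ℚ
  difference≡0 M = trans (cong (_- rhs) (ζ*≤-rhsIndices k n M)) (ℚₚ.+-inverseʳ rhs)
    where rhs = sumℚ (map (λ ks → ζ≤ ks M) (rhsIndices k n))
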